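{- For every $n\geq1$, $x_n^{(2)}<x_n^{(4)}$.
   Context: $t(m)\in\{0,1\}$ is the parity of the number of ones in the binary expansion of $m$. For $a\in\{2,4\}$ (both satisfy $t(a)=t(1)=1$), define $x_1^{(a)}=a$ and, for $n\ge2$, $x_n^{(a)}$ is the smallest integer $y>x_{n-1}^{(a)}$ with $t(y)=t(n)$. -}

module Defs where

open import Data.Nat using (ℕ; zero; suc; _+_; _<_; _≤_; _/_; _%_)
open import Data.Bool using (Bool; true; false; not; _xor_)
open import Relation.Binary.PropositionalEquality using (_≡_)
open import Data.Product using (_×_)

-- t m = parity of the number of ones in the binary expansion of m
-- (Thue–Morse sequence): t 0 = 0, t (2m) = t m, t (2m+1) = 1 - t m.
-- Defined by recursion on a fuel argument (m itself suffices).
t-aux : ℕ → ℕ → Bool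
t-aux zero m = false
t-aux (suc k) zero = false
t-aux (suc k) (suc m) with (suc m) % 2
... | zero = t-aux k ((suc m) / 2)
... | suc _ = not (t-aux k ((suc m) / 2))

t : ℕ → Bool
t m = t-aux m m

-- x is the sequence x^{(a)} (indexed by n ≥ 1; the value at 0 is irrelevant):
-- x 1 = a, and for n ≥ 2, x n is the smallest y > x (n-1) with t y = t n.
IsSeq : ℕ → (ℕ → ℕ) → Set
IsSeq a x =
  (x 1 ≡ a) ×
  ((n : ℕ) → 1 ≤ n →
     (x n < x (suc n)) ×
     (t (x (suc n)) ≡ t (suc n)) ×
     ((y : ℕ) → x n < y → t y ≡ t (suc n) → x (suc n) ≤ y))

-- Every index n has the candidate value 2n, since t (2n) = t n, so the sequence
-- started at 2 stays at or below 2n. The sequence started at 4 stays at or above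
-- 2n + 2: it can never land on 2n + 1, because t (2n + 1) = not (t n).
module Submission where

open import Defs
open import Data.Nat using (ℕ; zero; suc; _+_; _*_; _/_; _%_; _<_; _≤_; z≤n; s≤s)
open import Data.Nat.Properties
  using (≤-refl; ≤-trans; ≤-reflexive; ≤-pred; n≤1+n; m≤m*n; ≤∧≢⇒<)
open import Data.Nat.DivMod using (m/n<m; m*n/n≡m; m*n%n≡0; [m+kn]%n≡m%n; +-distrib-/-∣ʳ)
open import Data.Nat.Divisibility using (divides-refl)
open import Data.Bool using (not)
open import Data.Bool.Properties using (not-¬)
open import Data.Product using (_,_)
open import Relation.Binary.PropositionalEquality using (_≡_; _≢_; refl; sym; trans; cong; module ≡-Reasoning)

half-≤ : ∀ m → suc m / 2 ≤ m
half-≤ m = ≤-pred (m/n<m (suc m) 2 (s≤s (s≤s z≤n)))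

[1+n*2]/2≡n : ∀ n → (1 + n * 2) / 2 ≡ n
[1+n*2]/2≡n n = trans (+-distrib-/-∣ʳ 1 {d = 2} (divides-refl n)) (m*n/n≡m n 2)

t-aux-fuel-irrelevant : ∀ k j m → m ≤ k → m ≤ j → t-aux k m ≡ t-aux j m
t-aux-fuel-irrelevant zero    zero    zero    _         _         = refl
t-aux-fuel-irrelevant zero    (suc j) zero    _         _         = refl
t-aux-fuel-irrelevant (suc k) zero    zero    _         _         = refl
t-aux-fuel-irrelevant (suc k) (suc j) zero    _         _         = refl
t-aux-fuel-irrelevant (suc k) (suc j) (suc m) (s≤s m≤k) (s≤s m≤j) with suc m % 2
... | zero  = t-aux-fuel-irrelevant k j (suc m / 2)
                (≤-trans (half-≤ m) m≤k) (≤-trans (half-≤ m) m≤j)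
... | suc _ = cong not (t-aux-fuel-irrelevant k j (suc m / 2)
                (≤-trans (half-≤ m) m≤k) (≤-trans (half-≤ m) m≤j))

t-aux≡t : ∀ {k m} → m ≤ k → t-aux k m ≡ t m
t-aux≡t {k} {m} m≤k = t-aux-fuel-irrelevant k m m m≤k ≤-refl

t-aux-suc-even : ∀ k m → suc m % 2 ≡ 0 → t-aux (suc k) (suc m) ≡ t-aux k (suc m / 2)
t-aux-suc-even k m _ with suc m % 2
t-aux-suc-even k m refl | .0 = refl

t-aux-suc-odd : ∀ k m → suc m % 2 ≡ 1 → t-aux (suc k) (suc m) ≡ not (t-aux k (suc m / 2))
t-aux-suc-odd k m _ with suc m % 2
t-aux-suc-odd k m refl | .1 = refl

t-double : ∀ n → t (n * 2) ≡ t n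
t-double zero    = refl
t-double (suc n) = begin
  t (suc n * 2)                      ≡⟨ t-aux-suc-even (1 + n * 2) (1 + n * 2) (m*n%n≡0 (suc n) 2) ⟩
  t-aux (1 + n * 2) (suc n * 2 / 2)  ≡⟨ cong (t-aux _) (m*n/n≡m (suc n) 2) ⟩
  t-aux (1 + n * 2) (suc n)          ≡⟨ t-aux≡t (s≤s (m≤m*n n 2)) ⟩
  t (suc n)                          ∎
  where open ≡-Reasoning

t-double+1 : ∀ n → t (1 + n * 2) ≡ not (t n)
t-double+1 zero    = refl
t-double+1 (suc n) = begin
  t (1 + suc n * 2)
    ≡⟨ t-aux-suc-odd (suc n * 2) (suc n * 2) ([m+kn]%n≡m%n 1 (suc n) 2) ⟩
  not (t-aux (suc n * 2) ((1 + suc n * 2) / 2))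
    ≡⟨ cong (λ m → not (t-aux (suc n * 2) m)) ([1+n*2]/2≡n (suc n)) ⟩
  not (t-aux (suc n * 2) (suc n))
    ≡⟨ cong not (t-aux≡t (m≤m*n (suc n) 2)) ⟩
  not (t (suc n))
    ∎
  where open ≡-Reasoning

IsSeq-≤-double : ∀ {a x} → a ≤ 2 → IsSeq a x → ∀ n → x (suc n) ≤ suc n * 2
IsSeq-≤-double a≤2 (x1≡a , _) zero = ≤-trans (≤-reflexive x1≡a) a≤2
IsSeq-≤-double a≤2 seq@(_ , step) (suc n)
  with _ , _ , least ← step (suc n) (s≤s z≤n) =
  least (suc (suc n) * 2)
    (≤-trans (s≤s (IsSeq-≤-double a≤2 seq n)) (n≤1+n _))
    (t-double (suc (suc n)))

IsSeq-double+2-≤ : ∀ {a x} → 4 ≤ a → IsSeq a x → ∀ n → 2 + suc n * 2 ≤ x (suc n)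
IsSeq-double+2-≤ 4≤a (x1≡a , _) zero = ≤-trans 4≤a (≤-reflexive (sym x1≡a))
IsSeq-double+2-≤ {x = x} 4≤a seq@(_ , step) (suc n)
  with increasing , parity , _ ← step (suc n) (s≤s z≤n) =
  ≤∧≢⇒< (≤-trans (s≤s (IsSeq-double+2-≤ 4≤a seq n)) increasing) avoids-odd
  where
    avoids-odd : 1 + suc (suc n) * 2 ≢ x (suc (suc n))
    avoids-odd eq = not-¬ parity (trans (cong t (sym eq)) (t-double+1 (suc (suc n))))

corollary5 : (x₂ x₄ : ℕ → ℕ) → IsSeq 2 x₂ → IsSeq 4 x₄ →
    (n : ℕ) → 1 ≤ n → x₂ n < x₄ n
corollary5 x₂ x₄ s2 s4 (suc n) _ =
  ≤-trans (s≤s (IsSeq-≤-double ≤-refl s2 n))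
          (≤-trans (n≤1+n _) (IsSeq-double+2-≤ ≤-refl s4 n))
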